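{- Let $G'$ be the contracted graph of an arbitrary graph $G$ containing a hamilton circuit, and let $H'$ be a pseudo-hamilton circuit of $G'$ whose vertices are equally spaced clockwise along a circle $C$. Let $a$ be a pseudo-arc vertex of $H'$. Suppose $e_1=[H'(a),H'(d)]$ and $e_2=[d,H'(e)]$ are edges of $G'-H'$ which do not intersect in $C$, and that $[a,x]$ is an edge of $G'-H'$ determining a rotation $r$ of $H'$ such that $H'(a)$ is a pseudo-arc vertex of $H^*=H'r$. If, going in a clockwise direction along $H'$, $x$ lies between $H'(e)$ and $d$, then $e_1$ and $e_2$ intersect in the circle defined by $H^*$ and determine an $H^*$-admissible pseudo-3-cycle.
   Context: The contracted graph $G'$ of $G$: each maximal path of $G$ whose interior vertices all have degree $2$ is replaced by a single new vertex (a "2-vertex") adjacent to the neighbours of the path's endpoints, edges joining the two endpoints of such a path being deleted. A pseudo-hamilton circuit is a cyclic ordering of the vertex set ($H'(v)$ = successor of $v$); $v$ is a pseudo-arc vertex if $[v,H'(v)]$ is not an edge. Edges "intersect" in a circle if, drawn as chords between the equally spaced vertices, they cross. A rotation with respect to $a$ and $x$, for an edge $[a,x]$ not on $H'$, replaces the subpath $[a,H'(a),\dots,x]$ of $H'$ by $[a,x,\dots,H'(a)]$ (the segment from $H'(a)$ to $x$ reversed), the rest of the circuit unchanged. A pseudo-3-cycle $(p\,q\,z)$ determined by edges $[p,H^*(q)]$, $[q,H^*(z)]$ is $H^*$-admissible if $H^*(p\,q\,z)$ is again an $n$-cycle. -}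

module Defs where

open import Data.Nat using (ℕ; zero; suc; _<_; _≤_)
open import Data.Fin using (Fin; _≟_)
open import Data.Bool using (Bool; true; false; if_then_else_)
open import Data.List using (map; allFin)
open import Data.Nat.ListAction using (sum)
open import Data.Product using (Σ; ∃; ∃-syntax; _×_; _,_)
open import Data.Sum using (_⊎_)
open import Relation.Nullary using (¬_; does)
open import Relation.Binary.PropositionalEquality using (_≡_; _≢_)
open import Function.Definitions using (Injective)

record Graph : Set where
  field
    n       : ℕ
    adj     : Fin n → Fin n → Bool
    adj-sym : ∀ u v → adj u v ≡ adj v u
    adj-irr : ∀ v → adj v v ≡ false

open Graph public

V : Graph → Set
V G = Fin (n G)

deg : (G : Graph) → V G → ℕ
deg G v = sum (map (λ w → if adj G v w then 1 else 0) (allFin (n G)))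

iter : ∀ {m} → (Fin m → Fin m) → ℕ → Fin m → Fin m
iter f zero    v = v
iter f (suc k) v = f (iter f k v)

IsNCycle : ∀ {m} → (Fin m → Fin m) → Set
IsNCycle {m} f = Injective _≡_ _≡_ f × (∀ u v → ∃[ k ] iter f k u ≡ v)

HasHamiltonCircuit : Graph → Set
HasHamiltonCircuit G =
  3 ≤ n G × Σ (V G → V G) (λ h → IsNCycle h × (∀ v → adj G v (h v) ≡ true))

-- Path2 G u v : u and v are joined by a path all of whose vertices
-- (including u and v) have degree 2, i.e. they lie on a common maximal
-- degree-2 path.
data Path2 (G : Graph) : V G → V G → Set where
  here : ∀ {v} → deg G v ≡ 2 → Path2 G v v
  step : ∀ {u v w} → Path2 G u v → adj G v w ≡ true → deg G w ≡ 2 → Path2 G u w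

-- The edge [u,v] joins the two end-neighbours of a maximal degree-2 path
-- (such edges are deleted in the contraction).
JoinsEnds : (G : Graph) → V G → V G → Set
JoinsEnds G u v =
  deg G u ≢ 2 × deg G v ≢ 2 ×
  ∃[ w₁ ] ∃[ w₂ ] (Path2 G w₁ w₂ × adj G u w₁ ≡ true × adj G v w₂ ≡ true)

-- G' is (isomorphic to) the contracted graph of G: π maps each vertex of G
-- to the vertex of G' representing it; every maximal degree-2 path is
-- collapsed to a single vertex ("2-vertex"), other vertices are kept,
-- the 2-vertex is adjacent to the neighbours of the path's ends, and edges
-- joining the two end-neighbours of such a path are deleted.
record IsContraction (G G' : Graph) : Set where
  field
    π     : V G → V G'
    π-sur : ∀ p → ∃[ u ] π u ≡ p
    π-eq  : ∀ u v → π u ≡ π v → (u ≡ v ⊎ Path2 G u v)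
    eq-π  : ∀ u v → (u ≡ v ⊎ Path2 G u v) → π u ≡ π v
    adj-⇒ : ∀ p q → adj G' p q ≡ true →
              p ≢ q × ∃[ u ] ∃[ v ] (π u ≡ p × π v ≡ q × adj G u v ≡ true × ¬ JoinsEnds G u v)
    ⇒-adj : ∀ p q → p ≢ q → ∀ u v → π u ≡ p → π v ≡ q → adj G u v ≡ true →
              ¬ JoinsEnds G u v → adj G' p q ≡ true

PseudoArcVertex : (G : Graph) → (V G → V G) → V G → Set
PseudoArcVertex G H v = adj G v (H v) ≡ false

EdgeOff : (G : Graph) → (V G → V G) → V G → V G → Set
EdgeOff G H u v = adj G u v ≡ true × H u ≢ v × H v ≢ u

-- w lies strictly between u and v going clockwise (i.e. along H) from u to v
Between : ∀ {m} → (Fin m → Fin m) → Fin m → Fin m → Fin m → Set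
Between {m} H u v w =
  ∃[ i ] ∃[ j ] (0 < i × i < j × j < m × iter H i u ≡ w × iter H j u ≡ v)

-- The chords [a,b] and [c,d] of the circle on which the vertices are placed,
-- equally spaced in the cyclic order H, intersect: as closed chords they
-- have a common point (a common endpoint, or they cross).
Intersect : ∀ {m} → (Fin m → Fin m) → Fin m → Fin m → Fin m → Fin m → Set
Intersect H a b c d =
  (a ≡ c ⊎ a ≡ d ⊎ b ≡ c ⊎ b ≡ d) ⊎
  ((Between H a b c × Between H b a d) ⊎ (Between H a b d × Between H b a c))

-- Hs is the rotation of H with respect to a and x: the subpath
-- [a, H a, ..., x] of H is replaced by [a, x, ..., H a].
IsRotation : ∀ {m} → (Fin m → Fin m) → Fin m → Fin m → (Fin m → Fin m) → Set
IsRotation {m} H a x Hs = ∃[ k ]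
  ( k < m × iter H k a ≡ x
  × Hs a ≡ x
  × Hs (H a) ≡ H x
  × (∀ i → 2 ≤ i → i ≤ k → Hs (iter H i a) ≡ iter H (Data.Nat.pred i) a)
  × (∀ v → (∀ i → i ≤ k → iter H i a ≢ v) → Hs v ≡ H v))

compose3 : ∀ {m} → (Fin m → Fin m) → Fin m → Fin m → Fin m → Fin m → Fin m
compose3 H p q z v =
  if does (v ≟ p) then H q else
  if does (v ≟ q) then H z else
  if does (v ≟ z) then H p else H v

SameEdge : ∀ {m} → Fin m → Fin m → Fin m → Fin m → Set
SameEdge u v u' v' = (u ≡ u' × v ≡ v') ⊎ (u ≡ v' × v ≡ u')

Admissible3 : ∀ {m} → (Fin m → Fin m) → Fin m → Fin m → Fin m → Set
Admissible3 H p q z = p ≢ q × q ≢ z × p ≢ z × IsNCycle (compose3 H p q z)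

DetermineAdmissible3 : ∀ {m} → (Fin m → Fin m) → Fin m → Fin m → Fin m → Fin m → Set
DetermineAdmissible3 H u₁ v₁ u₂ v₂ = ∃[ p ] ∃[ q ] ∃[ z ]
  ( Admissible3 H p q z
  × ( (SameEdge u₁ v₁ p (H q) × SameEdge u₂ v₂ q (H z))
    ⊎ (SameEdge u₂ v₂ p (H q) × SameEdge u₁ v₁ q (H z))))

{-# OPTIONS --safe #-}

-- Number the vertices along H starting from H a, so that a comes last (position μ) and the
-- arc [H a, …, x] reversed by the rotation is an initial segment. Since the chords [H a, H d]
-- and [d, H e] do not meet in H, the order from H a must be H a, H e, x, d, H d, a
-- (positions 0 < ε < ξ < κ < μ); any other position of d makes the chords share an end or cross.
-- Then H* = H r runs
--   H a → H x → … → d → H d → … → a → x → … → H e → … → H a,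
-- where the chords cross. With z the H-successor of H e, so that H* z = H e, composing H* with
-- the 3-cycle (H a d z) gives the single cycle
--   H a → H d → … → a → x → … → z → H x → … → d → H e → … → H a.

module Submission where

open import Defs
open import Data.Bool using (true)
open import Data.Fin using (Fin; toℕ; fromℕ<; punchOut; _≟_)
open import Data.Fin.Properties using (any?; injective⇒≤; pigeonhole; punchOut-injective; toℕ<n; toℕ-fromℕ<)
open import Data.Nat using (ℕ; zero; suc; _+_; _*_; _∸_; _<_; _≤_; z≤n; s≤s; z<s; s≤s⁻¹; NonZero; >-nonZero)
open import Data.Nat.DivMod using (_%_; _/_; m≡m%n+[m/n]*n; m%n<n)
open import Data.Nat.Properties hiding (_≟_)
open import Data.Product using (_×_; _,_; ∃-syntax; proj₁; proj₂)
open import Data.Sum using (inj₁; inj₂)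
open import Function using (_∘_)
open import Function.Definitions using (Injective)
open import Relation.Binary.Definitions using (tri<; tri≈; tri>)
open import Relation.Binary.PropositionalEquality
open import Relation.Nullary using (¬_; yes; no; contradiction)

iter-+ : ∀ {m} (f : Fin m → Fin m) k l v → iter f (k + l) v ≡ iter f k (iter f l v)
iter-+ f zero    l v = refl
iter-+ f (suc k) l v = cong f (iter-+ f k l v)

iter-sucʳ : ∀ {m} (f : Fin m → Fin m) k v → iter f (suc k) v ≡ iter f k (f v)
iter-sucʳ f k v = trans (cong (λ n → iter f n v) (+-comm 1 k)) (iter-+ f k 1 v)

iter-injective : ∀ {m} {f : Fin m → Fin m} →
  Injective _≡_ _≡_ f → ∀ k → Injective _≡_ _≡_ (iter f k)
iter-injective f-inj zero    e = e
iter-injective f-inj (suc k) e = iter-injective f-inj k (f-inj e)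

iter-periodic : ∀ {m} (f : Fin m → Fin m) {p v} → iter f p v ≡ v → ∀ n → iter f (n * p) v ≡ v
iter-periodic f         fᵖv≡v zero    = refl
iter-periodic f {p} {v} fᵖv≡v (suc n) =
  trans (iter-+ f p (n * p) v) (trans (cong (iter f p) (iter-periodic f fᵖv≡v n)) fᵖv≡v)

iter-ascending : ∀ {m} {f : Fin m → Fin m} (g : ℕ → Fin m) {lo hi} →
  (∀ t → lo ≤ t → t < hi → f (g t) ≡ g (suc t)) →
  ∀ {s t} → lo ≤ s → s ≤ t → t ≤ hi → iter f (t ∸ s) (g s) ≡ g t
iter-ascending {f = f} g {lo} {hi} advance {s} {t} lo≤s s≤t t≤hi =
  subst (λ n → iter f (t ∸ s) (g s) ≡ g n) (m∸n+n≡m s≤t)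
        (ascend (t ∸ s) (subst (_≤ hi) (sym (m∸n+n≡m s≤t)) t≤hi))
  where
  ascend : ∀ c → c + s ≤ hi → iter f c (g s) ≡ g (c + s)
  ascend zero    _       = refl
  ascend (suc c) c+s<hi =
    trans (cong f (ascend c (<⇒≤ c+s<hi))) (advance (c + s) (≤-trans lo≤s (m≤n+m s c)) c+s<hi)

iter-descending : ∀ {m} {f : Fin m → Fin m} (g : ℕ → Fin m) {lo hi} →
  (∀ t → lo ≤ t → t < hi → f (g (suc t)) ≡ g t) →
  ∀ {s t} → lo ≤ s → s ≤ t → t ≤ hi → iter f (t ∸ s) (g t) ≡ g s
iter-descending {f = f} g {lo} {hi} advance {s} {t} lo≤s s≤t t≤hi =
  subst (λ n → iter f (t ∸ s) (g n) ≡ g s) (m∸n+n≡m s≤t)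
        (descend (t ∸ s) (subst (_≤ hi) (sym (m∸n+n≡m s≤t)) t≤hi))
  where
  descend : ∀ c → c + s ≤ hi → iter f c (g (c + s)) ≡ g s
  descend zero    _       = refl
  descend (suc c) c+s<hi = trans (iter-sucʳ f c (g (suc c + s)))
    (trans (cong (iter f c) (advance (c + s) (≤-trans lo≤s (m≤n+m s c)) c+s<hi))
           (descend c (<⇒≤ c+s<hi)))

endo-injective⇒surjective : ∀ {m} {f : Fin m → Fin m} →
  Injective _≡_ _≡_ f → ∀ v → ∃[ u ] f u ≡ v
endo-injective⇒surjective {suc m} {f} f-inj v with any? (λ u → f u ≟ v)
... | yes hit  = hit
... | no  miss = contradiction (injective⇒≤ punched-injective) 1+n≰n
  where
  avoids : ∀ u → v ≢ f u
  avoids u e = miss (u , sym e)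
  punched-injective : Injective _≡_ _≡_ (λ u → punchOut (avoids u))
  punched-injective e = f-inj (punchOut-injective (avoids _) (avoids _) e)

endo-surjective⇒injective : ∀ {m} {f : Fin m → Fin m} →
  (∀ v → ∃[ u ] f u ≡ v) → Injective _≡_ _≡_ f
endo-surjective⇒injective {f = f} onto = f-injective
  where
  section = proj₁ ∘ onto
  f∘section : ∀ w → f (section w) ≡ w
  f∘section = proj₂ ∘ onto
  section-injective : Injective _≡_ _≡_ section
  section-injective {w} {w'} e = trans (sym (f∘section w)) (trans (cong f e) (f∘section w'))
  f-injective : Injective _≡_ _≡_ f
  f-injective {u} {v} fu≡fv
    with endo-injective⇒surjective section-injective u | endo-injective⇒surjective section-injective v
  ... | u' , refl | v' , refl =
    cong section (trans (sym (f∘section u')) (trans fu≡fv (f∘section v')))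

Reachable : ∀ {m} → (Fin m → Fin m) → Fin m → Fin m → Set
Reachable f u v = ∃[ k ] iter f k u ≡ v

reachable-walk : ∀ {m} {f : Fin m → Fin m} {u v w} c →
  Reachable f u v → iter f c v ≡ w → Reachable f u w
reachable-walk {f = f} {u} c (k , refl) fᶜv≡w = c + k , trans (iter-+ f c k u) fᶜv≡w

single-orbit⇒IsNCycle : ∀ {m} {f : Fin m → Fin m} {b v} →
  (∀ w → Reachable f b w) → f v ≡ b → IsNCycle f
single-orbit⇒IsNCycle {f = f} {b} {v} reach fv≡b = endo-surjective⇒injective onto , connected
  where
  onto : ∀ w → ∃[ u ] f u ≡ w
  onto w with reach w
  ... | zero  , refl = v , fv≡b
  ... | suc k , refl = iter f k b , refl
  connected : ∀ u w → ∃[ n ] iter f n u ≡ w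
  connected u w with reach u | reach w | reach v
  ... | ku , refl | kw , refl | k , fᵏb≡v = kw + ku * k , (begin
    iter f (kw + ku * k) (iter f ku b)     ≡⟨ iter-+ f kw _ _ ⟩
    iter f kw (iter f (ku * k) (iter f ku b)) ≡⟨ cong (iter f kw) (sym (iter-+ f (ku * k) ku b)) ⟩
    iter f kw (iter f (ku * k + ku) b)     ≡⟨ cong (λ n → iter f kw (iter f n b)) ku*k+ku≡ku*[1+k] ⟩
    iter f kw (iter f (ku * suc k) b)      ≡⟨ cong (iter f kw) (iter-periodic f fᵏ⁺¹b≡b ku) ⟩
    iter f kw b                            ∎)
    where
    open ≡-Reasoning
    ku*k+ku≡ku*[1+k] = trans (+-comm (ku * k) ku) (sym (*-suc ku k))
    fᵏ⁺¹b≡b = trans (cong f fᵏb≡v) fv≡b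

module Enumeration {m} (H : Fin m → Fin m) (H-cycle : IsNCycle H) (b : Fin m) where

  R : ℕ → Fin m
  R t = iter H t b

  R-+ : ∀ c t → iter H c (R t) ≡ R (c + t)
  R-+ c t = sym (iter-+ H c t b)

  R-walk : ∀ {s t} → s ≤ t → iter H (t ∸ s) (R s) ≡ R t
  R-walk {s} {t} s≤t = trans (R-+ (t ∸ s) s) (cong R (m∸n+n≡m s≤t))

  R-mod : ∀ {p} .{{_ : NonZero p}} → R p ≡ b → ∀ k → R k ≡ R (k % p)
  R-mod {p} Rp≡b k = begin
    R k                                    ≡⟨ cong R (m≡m%n+[m/n]*n k p) ⟩
    R (k % p + k / p * p)                  ≡⟨ iter-+ H (k % p) _ b ⟩
    iter H (k % p) (iter H (k / p * p) b)  ≡⟨ cong (iter H (k % p)) (iter-periodic H Rp≡b (k / p)) ⟩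
    R (k % p)                              ∎
    where open ≡-Reasoning

  return-time-≥ : ∀ {p} → 0 < p → R p ≡ b → m ≤ p
  return-time-≥ {suc p} _ Rp≡b = injective⇒≤ index-injective
    where
    steps : Fin m → ℕ
    steps v = proj₁ (proj₂ H-cycle b v)
    index : Fin m → Fin (suc p)
    index v = fromℕ< (m%n<n (steps v) (suc p))
    R-index : ∀ v → R (toℕ (index v)) ≡ v
    R-index v = trans (cong R (toℕ-fromℕ< (m%n<n (steps v) (suc p))))
      (trans (sym (R-mod {suc p} Rp≡b (steps v))) (proj₂ (proj₂ H-cycle b v)))
    index-injective : Injective _≡_ _≡_ index
    index-injective {v} {w} e = trans (sym (R-index v)) (trans (cong (R ∘ toℕ) e) (R-index w))

  R-return : ∀ {s t} → s ≤ t → R s ≡ R t → R (t ∸ s) ≡ b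
  R-return {s} {t} s≤t Rs≡Rt = iter-injective (proj₁ H-cycle) s (begin
    iter H s (R (t ∸ s)) ≡⟨ R-+ s (t ∸ s) ⟩
    R (s + (t ∸ s))      ≡⟨ cong R (m+[n∸m]≡n s≤t) ⟩
    R t                  ≡⟨ sym Rs≡Rt ⟩
    R s                  ∎)
    where open ≡-Reasoning

  R-period : R m ≡ b
  R-period with pigeonhole (n<1+n m) (R ∘ toℕ)
  ... | s , t , s<t , Rs≡Rt =
    subst (λ n → R n ≡ b) (≤-antisym gap≤m (return-time-≥ (m<n⇒0<n∸m s<t) R-gap)) R-gap
    where
    R-gap : R (toℕ t ∸ toℕ s) ≡ b
    R-gap = R-return (<⇒≤ s<t) Rs≡Rt
    gap≤m : toℕ t ∸ toℕ s ≤ m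
    gap≤m = ≤-trans (m∸n≤m (toℕ t) (toℕ s)) (s≤s⁻¹ (toℕ<n t))

  R-periodic : ∀ t → R (m + t) ≡ R t
  R-periodic t = trans (cong R (+-comm m t)) (trans (iter-+ H t m b) (cong (iter H t) R-period))

  R-injective : ∀ {s t} → s < m → t < m → R s ≡ R t → s ≡ t
  R-injective {s} {t} s<m t<m Rs≡Rt with <-cmp s t
  ... | tri< s<t _ _ = contradiction (return-time-≥ (m<n⇒0<n∸m s<t) (R-return (<⇒≤ s<t) Rs≡Rt))
                                     (<⇒≱ (≤-<-trans (m∸n≤m t s) t<m))
  ... | tri≈ _ s≡t _ = s≡t
  ... | tri> _ _ t<s = contradiction (return-time-≥ (m<n⇒0<n∸m t<s) (R-return (<⇒≤ t<s) (sym Rs≡Rt)))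
                                     (<⇒≱ (≤-<-trans (m∸n≤m s t) s<m))

  R-surjective : ∀ v → ∃[ t ] t < m × R t ≡ v
  R-surjective v = k % m , m%n<n k m , trans (sym (R-mod R-period k)) Hᵏb≡v
    where
    instance
      m-nonZero : NonZero m
      m-nonZero = >-nonZero (≤-<-trans z≤n (toℕ<n v))
    k = proj₁ (proj₂ H-cycle b v)
    Hᵏb≡v = proj₂ (proj₂ H-cycle b v)

  R-between : ∀ {s t u} → s < t → t < u → u < s + m → Between H (R s) (R u) (R t)
  R-between {s} {t} {u} s<t t<u u<s+m =
    t ∸ s , u ∸ s , m<n⇒0<n∸m s<t , ∸-monoˡ-< t<u (<⇒≤ s<t) ,
    +-cancelʳ-< s (u ∸ s) m
      (subst (_< m + s) (sym (m∸n+n≡m s≤u)) (subst (u <_) (+-comm s m) u<s+m)) ,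
    R-walk (<⇒≤ s<t) , R-walk s≤u
    where
    s≤u = <⇒≤ (<-trans s<t t<u)

  Between-positions : ∀ {ε d x} → Between H (R ε) d x →
    ∃[ i ] ∃[ j ] (0 < i × i < j × j < m × x ≡ R (i + ε) × d ≡ R (j + ε))
  Between-positions {ε} (i , j , 0<i , i<j , j<m , Hⁱ≡x , Hʲ≡d) =
    i , j , 0<i , i<j , j<m , trans (sym Hⁱ≡x) (R-+ i ε) , trans (sym Hʲ≡d) (R-+ j ε)

module Compose3 {m} (f : Fin m → Fin m) (p q z : Fin m) where

  compose3-p : compose3 f p q z p ≡ f q
  compose3-p with p ≟ p
  ... | yes _   = refl
  ... | no  p≢p = contradiction refl p≢p

  compose3-q : q ≢ p → compose3 f p q z q ≡ f z
  compose3-q q≢p with q ≟ p | q ≟ q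
  ... | yes q≡p | _       = contradiction q≡p q≢p
  ... | no  _   | yes _   = refl
  ... | no  _   | no  q≢q = contradiction refl q≢q

  compose3-z : z ≢ p → z ≢ q → compose3 f p q z z ≡ f p
  compose3-z z≢p z≢q with z ≟ p | z ≟ q | z ≟ z
  ... | yes z≡p | _       | _       = contradiction z≡p z≢p
  ... | no  _   | yes z≡q | _       = contradiction z≡q z≢q
  ... | no  _   | no  _   | yes _   = refl
  ... | no  _   | no  _   | no  z≢z = contradiction refl z≢z

  compose3-other : ∀ {v} → v ≢ p → v ≢ q → v ≢ z → compose3 f p q z v ≡ f v
  compose3-other {v} v≢p v≢q v≢z with v ≟ p | v ≟ q | v ≟ z
  ... | yes v≡p | _       | _       = contradiction v≡p v≢p
  ... | no  _   | yes v≡q | _       = contradiction v≡q v≢q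
  ... | no  _   | no  _   | yes v≡z = contradiction v≡z v≢z
  ... | no  _   | no  _   | no  _   = refl

module Rotation {μ} (H : Fin (suc μ) → Fin (suc μ)) (H-cycle : IsNCycle H) (a : Fin (suc μ)) where

  open Enumeration H H-cycle (H a) public

  R-≢ : ∀ {s t} → s ≤ μ → t ≤ μ → s ≢ t → R s ≢ R t
  R-≢ s≤μ t≤μ s≢t = s≢t ∘ R-injective (s≤s s≤μ) (s≤s t≤μ)

  R[μ]≡a : R μ ≡ a
  R[μ]≡a = proj₁ H-cycle R-period

  clockwise-order : ∀ {ε j} → ε < suc μ → j < suc μ →
    H a ≢ R (suc (j + ε)) → R (suc (j + ε)) ≢ R ε →
    ¬ Intersect H (H a) (R (suc (j + ε))) (R (j + ε)) (R ε) →
    0 < ε × j + ε < μ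
  clockwise-order {ε} {j} ε<m j<m Ha≢Hd Hd≢y no-cross = 0<ε , κ<μ
    where
    m = suc μ
    κ = j + ε
    0<ε : 0 < ε
    0<ε = n≢0⇒n>0 (λ ε≡0 → no-cross (inj₁ (inj₂ (inj₁ (sym (cong R ε≡0))))))
    1+j<m : suc j < m
    1+j<m = ≤∧≢⇒< j<m (λ 1+j≡m → Hd≢y (trans (cong (λ n → R (n + ε)) 1+j≡m) (R-periodic ε)))
    crossing : m < κ → Intersect H (H a) (R (suc κ)) (R κ) (R ε)
    crossing m<κ = inj₂ (inj₁ (Ha-d-Hd , Hd-y-Ha))
      where
      Ha-d-Hd : Between H (H a) (R (suc κ)) (R κ)
      Ha-d-Hd = subst (λ v → Between H v (R (suc κ)) (R κ)) R-period
        (R-between m<κ (n<1+n κ) (+-mono-< 1+j<m ε<m))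
      Hd-y-Ha : Between H (R (suc κ)) (H a) (R ε)
      Hd-y-Ha = subst₂ (Between H (R (suc κ))) (trans (R-periodic m) R-period) (R-periodic ε)
        (R-between (+-monoˡ-< ε 1+j<m) (+-monoʳ-< m ε<m) (+-monoˡ-< m (m<n⇒m<1+n m<κ)))
    κ<μ : κ < μ
    κ<μ with <-cmp κ μ
    ... | tri< κ<μ _ _ = κ<μ
    ... | tri≈ _ κ≡μ _ = contradiction (trans (sym R-period) (cong (R ∘ suc) (sym κ≡μ))) Ha≢Hd
    ... | tri> _ _ μ<κ with m≤n⇒m<n∨m≡n μ<κ
    ...   | inj₁ m<κ = contradiction (crossing m<κ) no-cross
    ...   | inj₂ m≡κ = contradiction (inj₁ (inj₁ (trans (sym R-period) (cong R m≡κ)))) no-cross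

  record RotatedSuccessor (ξ : ℕ) (Hs : Fin (suc μ) → Fin (suc μ)) : Set where
    field
      at-a     : Hs (R μ) ≡ R ξ
      at-Ha    : Hs (R 0) ≡ R (suc ξ)
      reversed : ∀ t → t < ξ → Hs (R (suc t)) ≡ R t
      kept     : ∀ t → ξ < t → t < μ → Hs (R t) ≡ R (suc t)

  rotated-successor : ∀ {ξ Hs} → ξ < μ → IsRotation H a (R ξ) Hs → RotatedSuccessor ξ Hs
  rotated-successor ξ<μ (zero , _ , a≡x , _) =
    contradiction (trans R[μ]≡a a≡x) (R-≢ ≤-refl (<⇒≤ ξ<μ) (>⇒≢ ξ<μ))
  rotated-successor {ξ} {Hs} ξ<μ (suc k , 1+k<m , Hᵏ⁺¹a≡x , Hs-a , Hs-Ha , reverse , keep)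
    with R-injective (<-trans (n<1+n k) 1+k<m) (s≤s (<⇒≤ ξ<μ))
                     (trans (sym (iter-sucʳ H k a)) Hᵏ⁺¹a≡x)
  ... | refl = record
    { at-a     = subst (λ v → Hs v ≡ R ξ) (sym R[μ]≡a) Hs-a
    ; at-Ha    = Hs-Ha
    ; reversed = λ t t<ξ → trans (cong Hs (sym (iter-sucʳ H (suc t) a)))
                   (trans (reverse (suc (suc t)) (s≤s (s≤s z≤n)) (s≤s t<ξ)) (iter-sucʳ H t a))
    ; kept     = λ t ξ<t t<μ → keep (R t) (outside t ξ<t t<μ)
    }
    where
    outside : ∀ t → ξ < t → t < μ → ∀ s → s ≤ suc ξ → iter H s a ≢ R t
    outside t ξ<t t<μ zero    _          a≡Rt =
      R-≢ ≤-refl (<⇒≤ t<μ) (>⇒≢ t<μ) (trans R[μ]≡a a≡Rt)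
    outside t ξ<t t<μ (suc s) (s≤s s≤ξ) Hˢ⁺¹a≡Rt =
      R-≢ (≤-trans s≤ξ (<⇒≤ ξ<μ)) (<⇒≤ t<μ) (<⇒≢ (≤-<-trans s≤ξ ξ<t))
        (trans (sym (iter-sucʳ H s a)) Hˢ⁺¹a≡Rt)

  module Rotated {ε ξ κ} (0<ε : 0 < ε) (ε<ξ : ε < ξ) (ξ<κ : ξ < κ) (κ<μ : κ < μ)
                 {Hs} (rotated : RotatedSuccessor ξ Hs) where

    open RotatedSuccessor rotated

    ascend : ∀ {s t} → ξ < s → s ≤ t → t ≤ μ → iter Hs (t ∸ s) (R s) ≡ R t
    ascend = iter-ascending R kept

    descend : ∀ {s t} → s ≤ t → t ≤ ξ → iter Hs (t ∸ s) (R t) ≡ R s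
    descend = iter-descending R (λ t _ → reversed t) z≤n

    Hs-d : Hs (R κ) ≡ R (suc κ)
    Hs-d = kept κ ξ<κ κ<μ

    Ha-d-Hd : Between Hs (R 0) (R (suc κ)) (R κ)
    Ha-d-Hd = suc c , suc (suc c) , z<s , n<1+n (suc c) , s≤s (≤-<-trans c<κ κ<μ) ,
              to-d , trans (cong Hs to-d) Hs-d
      where
      c = κ ∸ suc ξ
      c<κ : c < κ
      c<κ = ∸-monoʳ-< z<s ξ<κ
      to-d : iter Hs (suc c) (R 0) ≡ R κ
      to-d = trans (iter-sucʳ Hs c (R 0))
        (trans (cong (iter Hs c) at-Ha) (ascend (n<1+n ξ) ξ<κ (<⇒≤ κ<μ)))

    Hd-y-Ha : Between Hs (R (suc κ)) (R 0) (R ε)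
    Hd-y-Ha = c , ε + c , <-≤-trans z<s (m≤n+m _ (ξ ∸ ε)) , m<n+m c 0<ε , bound , to-y ,
              trans (iter-+ Hs ε c (R (suc κ)))
                    (trans (cong (iter Hs ε) to-y) (descend z≤n (<⇒≤ ε<ξ)))
      where
      δ = μ ∸ suc κ
      c = ξ ∸ ε + suc δ
      to-y : iter Hs c (R (suc κ)) ≡ R ε
      to-y = trans (iter-+ Hs (ξ ∸ ε) (suc δ) (R (suc κ)))
        (trans (cong (iter Hs (ξ ∸ ε)) (trans (cong Hs (ascend (s≤s (<⇒≤ ξ<κ)) κ<μ ≤-refl)) at-a))
               (descend (<⇒≤ ε<ξ) ≤-refl))
      bound : ε + c < suc μ
      bound = begin-strict
        ε + (ξ ∸ ε + suc δ)   ≡⟨ sym (+-assoc ε (ξ ∸ ε) (suc δ)) ⟩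
        ε + (ξ ∸ ε) + suc δ   ≡⟨ cong (_+ suc δ) (m+[n∸m]≡n (<⇒≤ ε<ξ)) ⟩
        ξ + suc δ             <⟨ +-monoˡ-< (suc δ) (m<n⇒m<1+n ξ<κ) ⟩
        suc κ + suc δ         ≡⟨ +-suc (suc κ) δ ⟩
        suc (suc κ + δ)       ≡⟨ cong suc (m+[n∸m]≡n κ<μ) ⟩
        suc μ                 ∎
        where open ≤-Reasoning

    crossing : Intersect Hs (R 0) (R (suc κ)) (R κ) (R ε)
    crossing = inj₂ (inj₁ (Ha-d-Hd , Hd-y-Ha))

    F : Fin (suc μ) → Fin (suc μ)
    F = compose3 Hs (R 0) (R κ) (R (suc ε))

    open Compose3 Hs (R 0) (R κ) (R (suc ε))

    1+ε<κ : suc ε < κ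
    1+ε<κ = ≤-<-trans ε<ξ ξ<κ

    F-Hs : ∀ {t} → t ≤ μ → t ≢ 0 → t ≢ κ → t ≢ suc ε → F (R t) ≡ Hs (R t)
    F-Hs {t} t≤μ t≢0 t≢κ t≢1+ε = compose3-other {R t}
      (R-≢ t≤μ z≤n t≢0) (R-≢ t≤μ (<⇒≤ κ<μ) t≢κ)
      (R-≢ t≤μ (<⇒≤ (<-trans 1+ε<κ κ<μ)) t≢1+ε)

    F-Ha : F (R 0) ≡ R (suc κ)
    F-Ha = trans compose3-p Hs-d

    F-d : F (R κ) ≡ R ε
    F-d = trans (compose3-q (R-≢ (<⇒≤ κ<μ) z≤n (>⇒≢ (<-trans 0<ε (<-trans ε<ξ ξ<κ)))))
                (reversed ε ε<ξ)

    F-z : F (R (suc ε)) ≡ R (suc ξ)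
    F-z = trans (compose3-z (R-≢ 1+ε≤μ z≤n (λ ())) (R-≢ 1+ε≤μ (<⇒≤ κ<μ) (<⇒≢ 1+ε<κ))) at-Ha
      where 1+ε≤μ = <⇒≤ (<-trans 1+ε<κ κ<μ)

    F-a : F (R μ) ≡ R ξ
    F-a = trans (F-Hs ≤-refl (>⇒≢ (≤-<-trans z≤n κ<μ)) (>⇒≢ κ<μ) (>⇒≢ (<-trans 1+ε<κ κ<μ)))
                at-a

    F-below-y : ∀ t → t < ε → F (R (suc t)) ≡ R t
    F-below-y t t<ε = trans (F-Hs (<⇒≤ (<-trans (≤-<-trans t<ε ε<ξ) (<-trans ξ<κ κ<μ))) (λ ())
        (<⇒≢ (≤-<-trans t<ε (<-trans ε<ξ ξ<κ))) (<⇒≢ (s≤s t<ε)))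
      (reversed t (<-trans t<ε ε<ξ))

    F-below-x : ∀ t → suc ε ≤ t → t < ξ → F (R (suc t)) ≡ R t
    F-below-x t 1+ε≤t t<ξ = trans (F-Hs (<⇒≤ (<-trans (≤-<-trans t<ξ ξ<κ) κ<μ)) (λ ())
        (<⇒≢ (≤-<-trans t<ξ ξ<κ)) (>⇒≢ (s≤s 1+ε≤t)))
      (reversed t t<ξ)

    F-above-x : ∀ t → suc ξ ≤ t → t < κ → F (R t) ≡ R (suc t)
    F-above-x t ξ<t t<κ = trans (F-Hs (<⇒≤ (<-trans t<κ κ<μ)) (>⇒≢ (≤-<-trans z≤n ξ<t))
        (<⇒≢ t<κ) (>⇒≢ (<-≤-trans (s≤s ε<ξ) ξ<t)))
      (kept t ξ<t (<-trans t<κ κ<μ))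

    F-above-Hd : ∀ t → suc κ ≤ t → t < μ → F (R t) ≡ R (suc t)
    F-above-Hd t κ<t t<μ = trans (F-Hs (<⇒≤ t<μ) (>⇒≢ (≤-<-trans z≤n κ<t))
        (>⇒≢ κ<t) (>⇒≢ (<-trans 1+ε<κ κ<t)))
      (kept t (<-trans ξ<κ κ<t) t<μ)

    reach-Hd-to-a : ∀ {t} → suc κ ≤ t → t ≤ μ → Reachable F (R 0) (R t)
    reach-Hd-to-a {t} κ<t t≤μ =
      reachable-walk (t ∸ suc κ) (1 , F-Ha) (iter-ascending {f = F} R F-above-Hd ≤-refl κ<t t≤μ)

    reach-x-to-z : ∀ {t} → suc ε ≤ t → t ≤ ξ → Reachable F (R 0) (R t)
    reach-x-to-z {t} ε<t t≤ξ =
      reachable-walk (ξ ∸ t) (reachable-walk 1 (reach-Hd-to-a κ<μ ≤-refl) F-a)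
        (iter-descending {f = F} R F-below-x ε<t t≤ξ ≤-refl)

    reach-Hx-to-d : ∀ {t} → suc ξ ≤ t → t ≤ κ → Reachable F (R 0) (R t)
    reach-Hx-to-d {t} ξ<t t≤κ =
      reachable-walk (t ∸ suc ξ) (reachable-walk 1 (reach-x-to-z ≤-refl ε<ξ) F-z)
        (iter-ascending {f = F} R F-above-x ≤-refl ξ<t t≤κ)

    reach-y-to-Ha : ∀ {t} → t ≤ ε → Reachable F (R 0) (R t)
    reach-y-to-Ha {t} t≤ε =
      reachable-walk (ε ∸ t) (reachable-walk 1 (reach-Hx-to-d ξ<κ ≤-refl) F-d)
        (iter-descending {f = F} R (λ t _ → F-below-y t) z≤n t≤ε ≤-refl)

    reach : ∀ v → Reachable F (R 0) v
    reach v with R-surjective v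
    ... | t , s≤s t≤μ , refl with t ≤? ε | t ≤? ξ | t ≤? κ
    ... | yes t≤ε | _       | _       = reach-y-to-Ha t≤ε
    ... | no  t≰ε | yes t≤ξ | _       = reach-x-to-z (≰⇒> t≰ε) t≤ξ
    ... | no  _   | no  t≰ξ | yes t≤κ = reach-Hx-to-d (≰⇒> t≰ξ) t≤κ
    ... | no  _   | no  _   | no  t≰κ = reach-Hd-to-a (≰⇒> t≰κ) t≤μ

    admissible : DetermineAdmissible3 Hs (R 0) (R (suc κ)) (R κ) (R ε)
    admissible = R 0 , R κ , R (suc ε) ,
      ( R-≢ z≤n (<⇒≤ κ<μ) (<⇒≢ (≤-<-trans z≤n ξ<κ))
      , R-≢ (<⇒≤ κ<μ) (<⇒≤ (<-trans 1+ε<κ κ<μ)) (>⇒≢ 1+ε<κ)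
      , R-≢ z≤n (<⇒≤ (<-trans 1+ε<κ κ<μ)) (λ ())
      , single-orbit⇒IsNCycle {v = R 1} reach (F-below-y 0 0<ε) )
      , inj₁ (inj₁ (refl , sym Hs-d) , inj₁ (refl , sym (reversed ε ε<ξ)))

  crossing-and-admissible : ∀ {d x y} → H a ≢ H d → H d ≢ y → ¬ Intersect H (H a) (H d) d y →
    ∀ {Hs} → IsRotation H a x Hs → Between H y d x →
    Intersect Hs (H a) (H d) d y × DetermineAdmissible3 Hs (H a) (H d) d y
  crossing-and-admissible {y = y} Ha≢Hd Hd≢y no-cross rot y-d-x with R-surjective y
  ... | ε , ε<m , refl with Between-positions {ε} y-d-x
  ... | i , j , 0<i , i<j , j<m , refl , refl with clockwise-order ε<m j<m Ha≢Hd Hd≢y no-cross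
  ... | 0<ε , κ<μ = crossing , admissible
    where
    ε<ξ = m<n+m ε 0<i
    ξ<κ = +-monoˡ-< ε i<j
    open Rotated 0<ε ε<ξ ξ<κ κ<μ (rotated-successor (<-trans ξ<κ κ<μ) rot)

rotation-crossing : ∀ {m} (H : Fin m → Fin m) → IsNCycle H → ∀ {a d x y} →
  H a ≢ H d → H d ≢ y → ¬ Intersect H (H a) (H d) d y →
  ∀ {Hs} → IsRotation H a x Hs → Between H y d x →
  Intersect Hs (H a) (H d) d y × DetermineAdmissible3 Hs (H a) (H d) d y
rotation-crossing {zero}  _ _       {()}
rotation-crossing {suc μ} H H-cycle {a} = Rotation.crossing-and-admissible H H-cycle a

adjacent⇒≢ : ∀ G {u v : V G} → adj G u v ≡ true → u ≢ v
adjacent⇒≢ G {u} uv refl with trans (sym uv) (adj-irr G u)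
... | ()

theoremR : (G G' : Graph) → HasHamiltonCircuit G → IsContraction G G' →
    (H : V G' → V G') → IsNCycle H →
    (a d e x : V G') →
    PseudoArcVertex G' H a →
    EdgeOff G' H (H a) (H d) →
    EdgeOff G' H d (H e) →
    ¬ Intersect H (H a) (H d) d (H e) →
    EdgeOff G' H a x →
    (Hs : V G' → V G') → IsRotation H a x Hs →
    PseudoArcVertex G' Hs (H a) →
    Between H (H e) d x →
    Intersect Hs (H a) (H d) d (H e) × DetermineAdmissible3 Hs (H a) (H d) d (H e)
theoremR _ G' _ _ H H-cycle a d e x _ (Ha~Hd , _) (_ , Hd≢He , _) no-cross _ Hs rot _ He-d-x =
  rotation-crossing H H-cycle (adjacent⇒≢ G' Ha~Hd) Hd≢He no-cross rot He-d-x
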